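{- Let $G$ and $B$ be sets (possibly infinite). For each $g \in G$ let $B_g \subseteq B$ and for each $b \in B$ let $G_b \subseteq G$ (these sets may be infinite). Put $G_L = \{g \in G : B_g \neq \varnothing\}$ and $B_L = \{b \in B : G_b \neq \varnothing\}$. For $g \in G_L$ let $B^*_g = \{b \in B_g : b \notin B_L \text{ or } g \in G_b\}$, and for $b \in B_L$ let $G^*_b = \{g \in G_b : g \notin G_L \text{ or } b \in B_g\}$. Then there exists an injective partial function $P : G \to B$ with $G_L \subseteq \mathrm{Domain}(P)$, $B_L \subseteq \mathrm{Range}(P)$, $P(g) \in B_g$ for all $g \in G_L$, and $P^{ -1}(b) \in G_b$ for all $b \in B_L$, if and only if both of the following hold: (i) there is an injective function $T_1 : G_L \to B$ with $T_1(g) \in B^*_g$ for all $g \in G_L$; (ii) there is an injective function $T_2 : B_L \to G$ with $T_2(b) \in G^*_b$ for all $b \in B_L$.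
   Context: This is the (possibly infinite) "Symmetric Marriage Problem": $B_g$ is the list of boys girl $g$ is willing to marry and $G_b$ the list of girls boy $b$ is willing to marry; an empty list means the person has no list (is willing to marry anyone or no one). $G_L$, $B_L$ are the girls and boys with lists. -}

module Defs where

open import Data.Product using (Σ; ∃; _×_; _,_)
open import Data.Sum using (_⊎_)
open import Data.Maybe using (Maybe; just; nothing)
open import Relation.Nullary using (¬_)
open import Relation.Binary.PropositionalEquality using (_≡_)

-- A marriage instance: girls G, boys B, list of girl g is Bl g ⊆ B,
-- list of boy b is Gl b ⊆ G (subsets as predicates).
module Marriage {G B : Set} (Bl : G → B → Set) (Gl : B → G → Set) where

  GL : G → Set
  GL g = ∃ λ b → Bl g b

  BL : B → Set
  BL b = ∃ λ g → Gl b g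

  Bstar : G → B → Set
  Bstar g b = Bl g b × (¬ BL b ⊎ Gl b g)

  Gstar : B → G → Set
  Gstar b g = Gl b g × (¬ GL g ⊎ Bl g b)

  -- P : G ⇀ B is a partial function (nothing = undefined)
  Domain : (G → Maybe B) → G → Set
  Domain P g = ∃ λ b → P g ≡ just b

  Range : (G → Maybe B) → B → Set
  Range P b = ∃ λ g → P g ≡ just b

  InjectivePartial : (G → Maybe B) → Set
  InjectivePartial P = ∀ {g g' b} → P g ≡ just b → P g' ≡ just b → g ≡ g'

  GoodMarriage : (G → Maybe B) → Set
  GoodMarriage P =
    InjectivePartial P
    × (∀ g → GL g → Domain P g)
    × (∀ b → BL b → Range P b)
    × (∀ g b → GL g → P g ≡ just b → Bl g b)
    × (∀ g b → BL b → P g ≡ just b → Gl b g)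

  -- (i): injective T₁ : G_L → B with T₁(g) ∈ B*_g
  -- (T₁ takes g together with a proof of g ∈ G_L; injectivity is on the girl)
  CondI : Set
  CondI = Σ ((g : G) → GL g → B) λ T₁ →
            (∀ g g' p p' → T₁ g p ≡ T₁ g' p' → g ≡ g')
            × (∀ g p → Bstar g (T₁ g p))

  CondII : Set
  CondII = Σ ((b : B) → BL b → G) λ T₂ →
             (∀ b b' p p' → T₂ b p ≡ T₂ b' p' → b ≡ b')
             × (∀ b p → Gstar b (T₂ b p))

module Submission where

-- Call a pair (g , b) compatible when (g ∈ G_L → b ∈ B_g) and
-- (b ∈ B_L → g ∈ G_b): exactly the pairs a good marriage P may contain.
-- Under excluded middle, for g ∈ G_L the set B*_g is the set of boys
-- compatible with g, and dually for G*_b.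
--
-- (⇒) Restricting a good marriage P to G_L, resp. inverting it on B_L,
--     gives injections T₁, T₂ whose pairs are compatible, hence starred.
-- (⇐) A partial Schröder–Bernstein theorem: from partial injections
--     f : X ⇀ Y and h : Y ⇀ X one builds an injective partial P : X ⇀ Y,
--     defined on dom f, onto dom h, all of whose pairs are pairs of f or
--     of h⁻¹.  Girls whose backward f/h-chain stops at a boy outside the
--     image of f are sent along h⁻¹, all others along f.  Applied to T₁, T₂
--     every pair of P is starred, hence compatible, so P is good.
--
-- Excluded middle is used to decide chain membership, to make T₁, T₂
-- independent of the membership proofs they receive, and for the
-- characterisation of starred pairs.

open import Defs
open import Level using (0ℓ)
open import Axiom.ExcludedMiddle using (ExcludedMiddle)
open import Data.Product using (Σ; ∃; _×_; _,_; proj₁; proj₂)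
open import Data.Sum using (_⊎_; inj₁; inj₂)
open import Data.Maybe using (Maybe; just; nothing)
open import Data.Maybe.Properties using (just-injective)
open import Data.Empty using (⊥-elim)
open import Function.Bundles using (_⇔_; mk⇔)
open import Relation.Nullary using (¬_; Dec; yes; no)
open import Relation.Binary.PropositionalEquality using (_≡_; refl; sym; trans; cong; subst)

-- Under excluded middle every inhabited type has a canonical element, so a
-- function taking a proof as argument can be made independent of that proof.
module _ (em : ExcludedMiddle 0ℓ) where

  canonical : {A : Set} → A → A
  canonical {A} a with em {A}
  ... | yes a' = a'
  ... | no ¬a = ⊥-elim (¬a a)

  canonical-constant : {A : Set} (a a' : A) → canonical a ≡ canonical a'
  canonical-constant {A} a a' with em {A}
  ... | yes _ = refl
  ... | no ¬a = ⊥-elim (¬a a)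

module PartialBernstein (em : ExcludedMiddle 0ℓ) {X Y : Set}
    (Df : X → Set) (f : (x : X) → Df x → Y)
    (f-injective : ∀ x x' p p' → f x p ≡ f x' p' → x ≡ x')
    (Dh : Y → Set) (h : (y : Y) → Dh y → X)
    (h-injective : ∀ y y' p p' → h y p ≡ h y' p' → y ≡ y') where

  f̂ : (x : X) → Df x → Y
  f̂ x p = f x (canonical em p)

  ĥ : (y : Y) → Dh y → X
  ĥ y p = h y (canonical em p)

  f̂-irrelevant : ∀ x p p' → f̂ x p ≡ f̂ x p'
  f̂-irrelevant x p p' = cong (f x) (canonical-constant em p p')

  ĥ-irrelevant : ∀ y p p' → ĥ y p ≡ ĥ y p'
  ĥ-irrelevant y p p' = cong (h y) (canonical-constant em p p')

  InImage : Y → Set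
  InImage y = Σ X λ x → Σ (Df x) λ p → f̂ x p ≡ y

  -- RootedY y / RootedX x: following f̂⁻¹ and ĥ⁻¹ backwards from the point
  -- reaches, after finitely many steps, some y outside the image of f.
  data RootedY : Y → Set
  data RootedX : X → Set

  data RootedY where
    root  : ∀ {y} → ¬ InImage y → RootedY y
    fstep : ∀ {y} x p → f̂ x p ≡ y → RootedX x → RootedY y

  data RootedX where
    hstep : ∀ {x} y p → ĥ y p ≡ x → RootedY y → RootedX x

  rooted-f-preimage : ∀ {x y} p → f̂ x p ≡ y → RootedY y → RootedX x
  rooted-f-preimage {x} p e (root ¬im) = ⊥-elim (¬im (x , p , e))
  rooted-f-preimage {x} p e (fstep x' p' e' r) =
    subst RootedX (f-injective x' x _ _ (trans e' (sym e))) r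

  data Via (x : X) (y : Y) : Set where
    along-h : (p : Dh y) → ĥ y p ≡ x → RootedY y → Via x y
    along-f : ¬ RootedX x → (p : Df x) → f̂ x p ≡ y → Via x y

  via-injective : ∀ {x x' y} → Via x y → Via x' y → x ≡ x'
  via-injective (along-h p e _) (along-h p' e' _) = trans (sym e) (trans (ĥ-irrelevant _ p p') e')
  via-injective (along-h _ _ r) (along-f ¬r' p' e') = ⊥-elim (¬r' (rooted-f-preimage p' e' r))
  via-injective (along-f ¬r p e) (along-h _ _ r') = ⊥-elim (¬r (rooted-f-preimage p e r'))
  via-injective (along-f _ p e) (along-f _ p' e') = f-injective _ _ _ _ (trans e (sym e'))

  via-total : ∀ x → Df x → ∃ λ y → Via x y
  via-total x p with em {RootedX x}
  ... | yes (hstep y p' e r) = y , along-h p' e r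
  ... | no ¬r = f̂ x p , along-f ¬r p refl

  via-onto : ∀ y → Dh y → ∃ λ x → Via x y
  via-onto y p with em {RootedY y}
  ... | yes r = ĥ y p , along-h p refl r
  ... | no ¬r with em {InImage y}
  ...   | yes (x , p' , e) = x , along-f (λ r → ¬r (fstep x p' e r)) p' e
  ...   | no ¬im = ⊥-elim (¬r (root ¬im))

  assign : (x : X) → Dec (RootedX x) → Dec (Df x) → Maybe Y
  assign x (yes (hstep y _ _ _)) _ = just y
  assign x (no _) (yes p) = just (f̂ x p)
  assign x (no _) (no _) = nothing

  P : X → Maybe Y
  P x = assign x em em

  assign-via : ∀ {x y} d d' → assign x d d' ≡ just y → Via x y
  assign-via (yes (hstep y p e r)) _ refl = along-h p e r
  assign-via (no ¬r) (yes p) refl = along-f ¬r p refl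
  assign-via (no _) (no _) ()

  via-assign : ∀ {x y} → Via x y → ∀ d d' → assign x d d' ≡ just y
  via-assign (along-h p e _) (yes (hstep y' p' e' _)) _ =
    cong just (h-injective _ _ _ _ (trans e' (sym e)))
  via-assign (along-h p e r) (no ¬r) _ = ⊥-elim (¬r (hstep _ p e r))
  via-assign (along-f ¬r _ _) (yes r) _ = ⊥-elim (¬r r)
  via-assign {x} (along-f _ p e) (no _) (yes p') = cong just (trans (f̂-irrelevant x p' p) e)
  via-assign (along-f _ p _) (no _) (no ¬p) = ⊥-elim (¬p p)

  P-injective : ∀ {x x' y} → P x ≡ just y → P x' ≡ just y → x ≡ x'
  P-injective e e' = via-injective (assign-via em em e) (assign-via em em e')

  P-domain : ∀ x → Df x → ∃ λ y → P x ≡ just y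
  P-domain x p with via-total x p
  ... | y , v = y , via-assign v em em

  P-range : ∀ y → Dh y → ∃ λ x → P x ≡ just y
  P-range y p with via-onto y p
  ... | x , v = x , via-assign v em em

  P-origin : ∀ {x y} → P x ≡ just y → (Σ (Df x) λ p → f x p ≡ y) ⊎ (Σ (Dh y) λ p → h y p ≡ x)
  P-origin e with assign-via em em e
  ... | along-h p e' _ = inj₂ (canonical em p , e')
  ... | along-f _ p e' = inj₁ (canonical em p , e')

module MarriageFacts (em : ExcludedMiddle 0ℓ) {G B : Set} (Bl : G → B → Set) (Gl : B → G → Set) where
  open Marriage Bl Gl

  Compatible : G → B → Set
  Compatible g b = (GL g → Bl g b) × (BL b → Gl b g)

  Bstar⇒compatible : ∀ {g b} → Bstar g b → Compatible g b
  Bstar⇒compatible (bl , inj₁ ¬bL) = (λ _ → bl) , (λ bL → ⊥-elim (¬bL bL))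
  Bstar⇒compatible (bl , inj₂ gl) = (λ _ → bl) , (λ _ → gl)

  Gstar⇒compatible : ∀ {g b} → Gstar b g → Compatible g b
  Gstar⇒compatible (gl , inj₁ ¬gL) = (λ gL → ⊥-elim (¬gL gL)) , (λ _ → gl)
  Gstar⇒compatible (gl , inj₂ bl) = (λ _ → bl) , (λ _ → gl)

  compatible⇒Bstar : ∀ {g b} → GL g → Compatible g b → Bstar g b
  compatible⇒Bstar {b = b} gL (bl , gl) with em {BL b}
  ... | yes bL = bl gL , inj₂ (gl bL)
  ... | no ¬bL = bl gL , inj₁ ¬bL

  compatible⇒Gstar : ∀ {g b} → BL b → Compatible g b → Gstar b g
  compatible⇒Gstar {g = g} bL (bl , gl) with em {GL g}
  ... | yes gL = gl bL , inj₂ (bl gL)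
  ... | no ¬gL = gl bL , inj₁ ¬gL

  good⇒conditions : Σ (G → Maybe B) GoodMarriage → CondI × CondII
  good⇒conditions (P , injective , domain , range , inBl , inGl) =
    (T₁ , T₁-injective , T₁-starred) , (T₂ , T₂-injective , T₂-starred)
    where
    compatible : ∀ {g b} → P g ≡ just b → Compatible g b
    compatible {g} {b} e = (λ gL → inBl g b gL e) , (λ bL → inGl g b bL e)

    T₁ : (g : G) → GL g → B
    T₁ g gL = proj₁ (domain g gL)

    T₁-injective : ∀ g g' p p' → T₁ g p ≡ T₁ g' p' → g ≡ g'
    T₁-injective g g' p p' e =
      injective (proj₂ (domain g p)) (trans (proj₂ (domain g' p')) (cong just (sym e)))

    T₁-starred : ∀ g p → Bstar g (T₁ g p)
    T₁-starred g p = compatible⇒Bstar p (compatible (proj₂ (domain g p)))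

    T₂ : (b : B) → BL b → G
    T₂ b bL = proj₁ (range b bL)

    T₂-injective : ∀ b b' p p' → T₂ b p ≡ T₂ b' p' → b ≡ b'
    T₂-injective b b' p p' e =
      just-injective (trans (sym (proj₂ (range b p))) (trans (cong P e) (proj₂ (range b' p'))))

    T₂-starred : ∀ b p → Gstar b (T₂ b p)
    T₂-starred b p = compatible⇒Gstar p (compatible (proj₂ (range b p)))

  conditions⇒good : CondI × CondII → Σ (G → Maybe B) GoodMarriage
  conditions⇒good ((T₁ , T₁-injective , T₁-starred) , (T₂ , T₂-injective , T₂-starred)) =
    P , P-injective , P-domain , P-range
      , (λ g b gL e → proj₁ (compatible e) gL)
      , (λ g b bL e → proj₂ (compatible e) bL)
    where
    open PartialBernstein em GL T₁ T₁-injective BL T₂ T₂-injective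

    compatible : ∀ {g b} → P g ≡ just b → Compatible g b
    compatible {g} {b} e with P-origin e
    ... | inj₁ (p , e') = Bstar⇒compatible (subst (Bstar g) e' (T₁-starred g p))
    ... | inj₂ (p , e') = Gstar⇒compatible (subst (Gstar b) e' (T₂-starred b p))

theorem4 : ExcludedMiddle 0ℓ → {G B : Set} (Bl : G → B → Set) (Gl : B → G → Set) →
    (Σ (G → Maybe B) (Marriage.GoodMarriage Bl Gl)) ⇔ (Marriage.CondI Bl Gl × Marriage.CondII Bl Gl)
theorem4 em Bl Gl = mk⇔ good⇒conditions conditions⇒good
  where open MarriageFacts em Bl Gl
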